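{- Every $\textsl{DL-Lite}^{\Box}_{\textit{bool}/\textit{core}}$ ontology and every $\textsl{DL-Lite}^{\Box}_{\textit{bool}/\textit{horn}^+}$ ontology is role-monotone.
   Context: Temporal DL-Lite. Roles $S ::= P\mid P^-$ ($P$ a role name); temporalised roles $R ::= S\mid\Box_F R\mid\Box_P R$ (in the $\Box$ fragment only $\Box_F,\Box_P$ are used); basic concepts $A\mid\exists S$; temporalised concepts analogously. CIs/RIs: $\vartheta_1\sqcap\dots\sqcap\vartheta_k\sqsubseteq\vartheta_{k+1}\sqcup\dots\sqcup\vartheta_{k+m}$ (empty $\sqcap=\top$, empty $\sqcup=\bot$). An ontology $\mathcal O=\mathcal T\cup\mathcal R$ consists of a TBox $\mathcal T$ of CIs and an RBox $\mathcal R$ of RIs. $\textsl{DL-Lite}^{\Box}_{\textit{bool}/\boldsymbol r}$: CIs arbitrary; RIs satisfy $\boldsymbol r$, where $\textit{core}$: $k+m\le2$, $m\le1$; $\textit{horn}^+$: $m\le1$ and no temporal operator occurs on the left-hand side of any RI. Semantics: temporal interpretations $\mathcal I$ with nonempty domain and extensions $P^{\mathcal I(n)}\subseteq(\Delta^{\mathcal I})^2$ for $n\in\mathbb Z$; $(P^-)^{\mathcal I(n)}$ converse; $(\Box_F R)^{\mathcal I(n)}=\bigcap_{k>n}R^{\mathcal I(k)}$, $(\Box_P R)^{\mathcal I(n)}=\bigcap_{k<n}R^{\mathcal I(k)}$ (and $\bigcirc_F,\bigcirc_P$ as next/previous moment in general); an RI holds if the inclusion of extensions holds at every $n\in\mathbb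 Z$. Role types and canonical rods. Let $\mathsf{sub}_{\mathcal R}$ be the set of temporalised roles occurring (as subterms) in $\mathcal R$ together with their negations. A role type for $\mathcal R$ is a maximal subset $\rho\subseteq\mathsf{sub}_{\mathcal R}$ consistent with $\mathcal R$ (i.e. realised by some pair at some moment in some interpretation satisfying all RIs of $\mathcal R$). For a role type $\rho$ and $n\in\mathbb Z$, let $\boldsymbol r_\rho(n)$ be the set of temporalised roles $R$ such that for every interpretation $\mathcal I$ satisfying all RIs of $\mathcal R$ and all $u,v$ with $(u,v)\in R'^{\mathcal I(0)}$ for every (non-negated) temporalised role $R'\in\rho$, we have $(u,v)\in R^{\mathcal I(n)}$ (the $\mathcal R$-canonical rod of $\rho$). The RBox $\mathcal R$ (and any ontology with RBox $\mathcal R$) is role-monotone if for every role type $\rho$ for $\mathcal R$, every role $S$ and every $n\neq0$: if $S\in\boldsymbol r_\rho(n)$, then either $S\in\boldsymbol r_\rho(k)$ for all $k\ge n$, or $S\in\boldsymbol r_\rho(k)$ for all $k\le n$. -}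

module Defs where

open import Level using (Level; 0ℓ; Setω) renaming (suc to lsuc)
open import Data.Nat using (ℕ; _≤_; _+_)
open import Data.Integer using (ℤ; _<_) renaming (_≤_ to _≤ℤ_; 0ℤ to 0ℤ)
open import Data.List using (List; []; _∷_; _++_; length; concatMap)
open import Data.List.Relation.Unary.All using (All)
open import Data.List.Relation.Unary.Any using (Any)
open import Data.List.Membership.Propositional using (_∈_)
open import Data.List.Relation.Binary.Subset.Propositional using (_⊆_)
open import Data.Product using (Σ; _×_; ∃)
open import Data.Sum using (_⊎_)
open import Data.Unit using (⊤)
open import Data.Empty using (⊥)
open import Relation.Nullary using (¬_)
open import Relation.Binary.PropositionalEquality using (_≡_)
open import Axiom.ExcludedMiddle using (ExcludedMiddle)

data Role : Set where
  name : ℕ → Role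
  inv  : ℕ → Role

data TRole : Set where
  role : Role → TRole
  □F   : TRole → TRole
  □P   : TRole → TRole

data BConcept : Set where
  atom : ℕ → BConcept
  ex   : Role → BConcept

data TConcept : Set where
  basic : BConcept → TConcept
  □Fc   : TConcept → TConcept
  □Pc   : TConcept → TConcept

-- Concept inclusion  ϑ₁ ⊓ … ⊓ ϑₖ ⊑ ϑₖ₊₁ ⊔ … ⊔ ϑₖ₊ₘ
record CI : Set where
  constructor _⊑c_
  field
    lhs : List TConcept
    rhs : List TConcept

record RI : Set where
  constructor _⊑r_
  field
    lhs : List TRole
    rhs : List TRole

RBox : Set
RBox = List RI

TBox : Set
TBox = List CI

record Ontology : Set where
  field
    tbox : TBox
    rbox : RBox

CoreRI : RI → Set
CoreRI (l ⊑r r) = (length l + length r ≤ 2) × (length r ≤ 1)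

NonTemporal : TRole → Set
NonTemporal (role _) = ⊤
NonTemporal (□F _)   = ⊥
NonTemporal (□P _)   = ⊥

HornPlusRI : RI → Set
HornPlusRI (l ⊑r r) = (length r ≤ 1) × All NonTemporal l

-- DL-Lite^□_{bool/core} and DL-Lite^□_{bool/horn⁺} ontologies
-- (CIs are arbitrary, i.e. bool; only the RIs are restricted)
BoolCore : Ontology → Set
BoolCore O = All CoreRI (Ontology.rbox O)

BoolHornPlus : Ontology → Set
BoolHornPlus O = All HornPlusRI (Ontology.rbox O)

record Interp : Set₁ where
  field
    Δ      : Set
    elem   : Δ                       -- nonempty domain
    conc   : ℕ → ℤ → Δ → Set
    roleEx : ℕ → ℤ → Δ → Δ → Set

open Interp

ext : (I : Interp) → TRole → ℤ → Δ I → Δ I → Set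
ext I (role (name p)) n u v = roleEx I p n u v
ext I (role (inv p))  n u v = roleEx I p n v u
ext I (□F R) n u v = ∀ k → n < k → ext I R k u v
ext I (□P R) n u v = ∀ k → k < n → ext I R k u v

SatRI : Interp → RI → Set
SatRI I (l ⊑r r) = ∀ (n : ℤ) (u v : Δ I) →
  All (λ R → ext I R n u v) l → Any (λ R → ext I R n u v) r

SatRBox : Interp → RBox → Set
SatRBox I ℛ = All (SatRI I) ℛ

subterms : TRole → List TRole
subterms (role S) = role S ∷ []
subterms (□F R)   = □F R ∷ subterms R
subterms (□P R)   = □P R ∷ subterms R

rolesOf : RBox → List TRole
rolesOf = concatMap (λ { (l ⊑r r) → concatMap subterms (l ++ r) })

data Lit : Set where
  pos : TRole → Lit
  neg : TRole → Lit

sub : RBox → List Lit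
sub ℛ = concatMap (λ R → pos R ∷ neg R ∷ []) (rolesOf ℛ)

HoldsLit : (I : Interp) → Lit → ℤ → Δ I → Δ I → Set
HoldsLit I (pos R) n u v = ext I R n u v
HoldsLit I (neg R) n u v = ¬ ext I R n u v

ConsistentWith : RBox → List Lit → Set₁
ConsistentWith ℛ ρ = Σ Interp λ I → SatRBox I ℛ × Σ ℤ λ n → Σ (Δ I) λ u → Σ (Δ I) λ v →
  All (λ L → HoldsLit I L n u v) ρ

-- role type: maximal subset of sub ℛ consistent with ℛ
-- (subsets of the finite set sub ℛ represented by lists, compared by membership)
record RoleType (ℛ : RBox) (ρ : List Lit) : Set₁ where
  field
    subset     : ρ ⊆ sub ℛ
    consistent : ConsistentWith ℛ ρ
    maximal    : ∀ (σ : List Lit) → σ ⊆ sub ℛ → ρ ⊆ σ → ConsistentWith ℛ σ → σ ⊆ ρ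

InRod : RBox → List Lit → ℤ → TRole → Set₁
InRod ℛ ρ n R = ∀ (I : Interp) → SatRBox I ℛ → ∀ (u v : Δ I) →
  (∀ R′ → pos R′ ∈ ρ → ext I R′ 0ℤ u v) → ext I R n u v

RoleMonotone : RBox → Set₁
RoleMonotone ℛ = ∀ (ρ : List Lit) → RoleType ℛ ρ → ∀ (S : Role) (n : ℤ) → ¬ (n ≡ 0ℤ) →
  InRod ℛ ρ n (role S) →
  (∀ k → n ≤ℤ k → InRod ℛ ρ k (role S)) ⊎ (∀ k → k ≤ℤ n → InRod ℛ ρ k (role S))

RoleMonotoneOnt : Ontology → Set₁
RoleMonotoneOnt O = RoleMonotone (Ontology.rbox O)

-- classical metatheory (the paper's semantics is classical set theory)
Classical : Setω
Classical = ∀ {ℓ : Level} → ExcludedMiddle ℓ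

{-# OPTIONS --safe #-}
-- Horn⁺: reindexing time along a strictly increasing map f with f 0 = 0 preserves every
-- horn⁺ RI (its left-hand side is atemporal, and a boxed role on the right only has to hold
-- at fewer moments after reindexing) as well as the realisation of ρ at 0, so a role in the
-- rod at n lies in the rod at f n; stretching the half-line containing n reaches every moment
-- farther from 0.
-- Core: given countermodels at some k₁ ≥ n and some k₂ ≤ n, take their product (which keeps
-- every RI with at most one disjunct) and restrict each role name to the pairs related at 0 or
-- throughout a ray from the current moment. Boxed roles are automatically of that kind, so this
-- steady part still satisfies the core RIs and realises ρ at 0; but there a role holding at
-- n ≠ 0 holds on a ray from n, hence at k₁ or at k₂, refuting one countermodel.
module Submission where

open import Defs
open import Data.Product using (_×_; ∃; _,_; proj₁; proj₂)
open import Level using (0ℓ) renaming (suc to lsuc)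
open import Function using (_∘_)
open import Data.Nat using (_≤_; s≤s)
open import Data.Integer using (ℤ; _<_; _+_; _-_; _≤?_; 0ℤ) renaming (_≤_ to _≤ℤ_)
open import Data.Integer.Properties
  using (<-cmp; ≤-<-trans; <-≤-trans; <⇒≤; <⇒≱; +-monoˡ-<; +-monoʳ-≤; +-identityʳ;
         i≤j⇒0≤j-i; i≤j⇒i-j≤0)
open import Data.Integer.Tactic.RingSolver using (solve-∀)
open import Data.List using (List; []; _∷_; length)
open import Data.List.Relation.Unary.All as All using (All; []; _∷_)
open import Data.List.Relation.Unary.Any as Any using (Any; here)
open import Data.List.Relation.Unary.Any.Properties using (singleton⁻)
open import Data.List.Membership.Propositional using (_∈_)
open import Data.Sum using (_⊎_; inj₁; inj₂; map₂)
open import Data.Empty using (⊥; ⊥-elim)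
open import Data.Unit using (tt)
open import Relation.Nullary using (¬_; yes; no; contradiction)
open import Relation.Binary.Definitions using (Monotonic₁; tri<; tri≈; tri>)
open import Relation.Binary.PropositionalEquality using (_≡_; refl; sym; trans; subst)

open Interp

SatRBox-map : ∀ {P : RI → Set} {I J : Interp} →
  (∀ {ri} → P ri → SatRI I ri → SatRI J ri) →
  ∀ {ℛ} → All P ℛ → SatRBox I ℛ → SatRBox J ℛ
SatRBox-map f ps sats = All.zipWith (λ (p , s) → f p s) (ps , sats)

Realises : List Lit → (I : Interp) → Δ I → Δ I → Set
Realises ρ I u v = ∀ R → pos R ∈ ρ → ext I R 0ℤ u v

reindex : Interp → (ℤ → ℤ) → Interp
reindex I f = record
  { Δ = Δ I ; elem = elem I
  ; conc = λ a t → conc I a (f t)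
  ; roleEx = λ p t → roleEx I p (f t)
  }

module _ {I : Interp} {f : ℤ → ℤ} (f-mono : Monotonic₁ _<_ _<_ f) where

  reindex-ext⁺ : ∀ R {t u v} → ext I R (f t) u v → ext (reindex I f) R t u v
  reindex-ext⁺ (role (name p)) h = h
  reindex-ext⁺ (role (inv p))  h = h
  reindex-ext⁺ (□F R) h k t<k = reindex-ext⁺ R (h (f k) (f-mono t<k))
  reindex-ext⁺ (□P R) h k k<t = reindex-ext⁺ R (h (f k) (f-mono k<t))

  reindex-ext⁻ : ∀ {R} → NonTemporal R → ∀ {t u v} → ext (reindex I f) R t u v → ext I R (f t) u v
  reindex-ext⁻ {role (name p)} _ h = h
  reindex-ext⁻ {role (inv p)}  _ h = h

  reindex-satRI : ∀ {ri} → HornPlusRI ri → SatRI I ri → SatRI (reindex I f) ri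
  reindex-satRI {l ⊑r r} (_ , nonTemporal) sat t u v hs =
    Any.map (λ {R} → reindex-ext⁺ R)
      (sat (f t) u v (All.zipWith (λ (nt , h) → reindex-ext⁻ nt h) (nonTemporal , hs)))

inRod-reindex : ∀ {ℛ ρ S n f} → All HornPlusRI ℛ → Monotonic₁ _<_ _<_ f → f 0ℤ ≡ 0ℤ →
  InRod ℛ ρ n (role S) → InRod ℛ ρ (f n) (role S)
inRod-reindex {S = S} {f = f} hornPlus f-mono f0≡0 rod I sat u v real =
  reindex-ext⁻ f-mono {role S} tt (rod (reindex I f) (SatRBox-map (reindex-satRI f-mono) hornPlus sat) u v real′)
  where
  real′ : Realises _ (reindex I f) u v
  real′ R R∈ρ = reindex-ext⁺ f-mono R (subst (λ t → ext I R t u v) (sym f0≡0) (real R R∈ρ))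

shiftPositive : ℤ → ℤ → ℤ
shiftPositive d t with t ≤? 0ℤ
... | yes _ = t
... | no  _ = t + d

shiftPositive-mono : ∀ {d} → 0ℤ ≤ℤ d → Monotonic₁ _<_ _<_ (shiftPositive d)
shiftPositive-mono {d} 0≤d {s} {t} s<t with s ≤? 0ℤ | t ≤? 0ℤ
... | yes _   | yes _   = s<t
... | yes _   | no  _   = <-≤-trans s<t (subst (_≤ℤ t + d) (+-identityʳ t) (+-monoʳ-≤ t 0≤d))
... | no  s≰0 | yes t≤0 = contradiction (<⇒≤ (<-≤-trans s<t t≤0)) s≰0
... | no  _   | no  _   = +-monoˡ-< d s<t

shiftPositive-positive : ∀ d {n} → 0ℤ < n → shiftPositive d n ≡ n + d
shiftPositive-positive d {n} 0<n with n ≤? 0ℤ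
... | yes n≤0 = contradiction n≤0 (<⇒≱ 0<n)
... | no  _   = refl

shiftNegative : ℤ → ℤ → ℤ
shiftNegative d t with 0ℤ ≤? t
... | yes _ = t
... | no  _ = t + d

shiftNegative-mono : ∀ {d} → d ≤ℤ 0ℤ → Monotonic₁ _<_ _<_ (shiftNegative d)
shiftNegative-mono {d} d≤0 {s} {t} s<t with 0ℤ ≤? s | 0ℤ ≤? t
... | yes _   | yes _   = s<t
... | yes 0≤s | no  0≰t = contradiction (<⇒≤ (≤-<-trans 0≤s s<t)) 0≰t
... | no  _   | yes _   = ≤-<-trans (subst (s + d ≤ℤ_) (+-identityʳ s) (+-monoʳ-≤ s d≤0)) s<t
... | no  _   | no  _   = +-monoˡ-< d s<t

shiftNegative-negative : ∀ d {n} → n < 0ℤ → shiftNegative d n ≡ n + d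
shiftNegative-negative d {n} n<0 with 0ℤ ≤? n
... | yes 0≤n = contradiction 0≤n (<⇒≱ n<0)
... | no  _   = refl

n+[k-n]≡k : ∀ n k → n + (k - n) ≡ k
n+[k-n]≡k = solve-∀

module _ {ℛ : RBox} {ρ : List Lit} {S : Role} (hornPlus : All HornPlusRI ℛ) where

  inRod-later : ∀ {n k} → 0ℤ < n → n ≤ℤ k → InRod ℛ ρ n (role S) → InRod ℛ ρ k (role S)
  inRod-later {n} {k} 0<n n≤k rod =
    subst (λ t → InRod ℛ ρ t (role S)) (trans (shiftPositive-positive (k - n) 0<n) (n+[k-n]≡k n k))
      (inRod-reindex {S = S} {n} hornPlus (shiftPositive-mono (i≤j⇒0≤j-i n≤k)) refl rod)

  inRod-earlier : ∀ {n k} → n < 0ℤ → k ≤ℤ n → InRod ℛ ρ n (role S) → InRod ℛ ρ k (role S)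
  inRod-earlier {n} {k} n<0 k≤n rod =
    subst (λ t → InRod ℛ ρ t (role S)) (trans (shiftNegative-negative (k - n) n<0) (n+[k-n]≡k n k))
      (inRod-reindex {S = S} {n} hornPlus (shiftNegative-mono (i≤j⇒i-j≤0 k≤n)) refl rod)

hornPlus-roleMonotone : ∀ {ℛ} → All HornPlusRI ℛ → RoleMonotone ℛ
hornPlus-roleMonotone {ℛ} hornPlus ρ _ S n n≢0 rod with <-cmp n 0ℤ
... | tri< n<0 _ _ = inj₂ λ k k≤n → inRod-earlier {ℛ} {ρ} {S} hornPlus n<0 k≤n rod
... | tri≈ _ n≡0 _ = contradiction n≡0 n≢0
... | tri> _ _ 0<n = inj₁ λ k n≤k → inRod-later {ℛ} {ρ} {S} hornPlus 0<n n≤k rod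

_⊗_ : Interp → Interp → Interp
I ⊗ J = record
  { Δ = Δ I × Δ J ; elem = elem I , elem J
  ; conc = λ a t x → conc I a t (proj₁ x) × conc J a t (proj₂ x)
  ; roleEx = λ p t x y → roleEx I p t (proj₁ x) (proj₁ y) × roleEx J p t (proj₂ x) (proj₂ y)
  }

module _ {I J : Interp} where

  ⊗-ext⁻ : ∀ R {t} {x y : Δ (I ⊗ J)} → ext (I ⊗ J) R t x y →
    ext I R t (proj₁ x) (proj₁ y) × ext J R t (proj₂ x) (proj₂ y)
  ⊗-ext⁻ (role (name p)) h = h
  ⊗-ext⁻ (role (inv p))  h = h
  ⊗-ext⁻ (□F R) h = (λ k t<k → proj₁ (⊗-ext⁻ R (h k t<k))) , (λ k t<k → proj₂ (⊗-ext⁻ R (h k t<k)))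
  ⊗-ext⁻ (□P R) h = (λ k k<t → proj₁ (⊗-ext⁻ R (h k k<t))) , (λ k k<t → proj₂ (⊗-ext⁻ R (h k k<t)))

  ⊗-ext⁺ : ∀ R {t} {x y : Δ (I ⊗ J)} →
    ext I R t (proj₁ x) (proj₁ y) × ext J R t (proj₂ x) (proj₂ y) → ext (I ⊗ J) R t x y
  ⊗-ext⁺ (role (name p)) h = h
  ⊗-ext⁺ (role (inv p))  h = h
  ⊗-ext⁺ (□F R) (hI , hJ) k t<k = ⊗-ext⁺ R (hI k t<k , hJ k t<k)
  ⊗-ext⁺ (□P R) (hI , hJ) k k<t = ⊗-ext⁺ R (hI k k<t , hJ k k<t)

  ⊗-satRI : ∀ {ri} → length (RI.rhs ri) ≤ 1 → SatRI I ri → SatRI J ri → SatRI (I ⊗ J) ri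
  ⊗-satRI {l ⊑r r} _ satI satJ t x y hs
    with satI t (proj₁ x) (proj₁ y) (All.map (λ {R} → proj₁ ∘ ⊗-ext⁻ R) hs)
       | satJ t (proj₂ x) (proj₂ y) (All.map (λ {R} → proj₂ ∘ ⊗-ext⁻ R) hs)
  ⊗-satRI {l ⊑r (R ∷ [])}    _        _ _ t x y hs | here hI | here hJ = here (⊗-ext⁺ R (hI , hJ))
  ⊗-satRI {l ⊑r (_ ∷ _ ∷ _)} (s≤s ()) _ _ t x y hs | _       | _

  ⊗-satRBox : ∀ {ℛ} → All (λ ri → length (RI.rhs ri) ≤ 1) ℛ → SatRBox I ℛ → SatRBox J ℛ → SatRBox (I ⊗ J) ℛ
  ⊗-satRBox rhs≤1 satI satJ =
    All.zipWith (λ ((r , sI) , sJ) → ⊗-satRI r sI sJ) (All.zip (rhs≤1 , satI) , satJ)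

Ray : (ℤ → Set) → ℤ → Set
Ray P t = (∀ k → t ≤ℤ k → P k) ⊎ (∀ k → k ≤ℤ t → P k)

Ray-map : ∀ {P Q : ℤ → Set} → (∀ k → P k → Q k) → ∀ {t} → Ray P t → Ray Q t
Ray-map f (inj₁ later)   = inj₁ λ k t≤k → f k (later k t≤k)
Ray-map f (inj₂ earlier) = inj₂ λ k k≤t → f k (earlier k k≤t)

Steady : (I : Interp) → TRole → ℤ → Δ I → Δ I → Set
Steady I R t u v = ext I R t u v × (t ≡ 0ℤ ⊎ Ray (λ k → ext I R k u v) t)

steadyPart : Interp → Interp
steadyPart I = record
  { Δ = Δ I ; elem = elem I ; conc = conc I
  ; roleEx = λ p → Steady I (role (name p))
  }

module _ {I : Interp} where

  steadyPart-ext⁻ : ∀ R {t u v} → ext (steadyPart I) R t u v → Steady I R t u v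
  steadyPart-ext⁻ (role (name p)) h = h
  steadyPart-ext⁻ (role (inv p))  h = h
  steadyPart-ext⁻ (□F R) h =
    (λ k t<k → proj₁ (steadyPart-ext⁻ R (h k t<k))) ,
    inj₂ (inj₁ λ k t≤k j k<j → proj₁ (steadyPart-ext⁻ R (h j (≤-<-trans t≤k k<j))))
  steadyPart-ext⁻ (□P R) h =
    (λ k k<t → proj₁ (steadyPart-ext⁻ R (h k k<t))) ,
    inj₂ (inj₂ λ k k≤t j j<k → proj₁ (steadyPart-ext⁻ R (h j (<-≤-trans j<k k≤t))))

  steadyPart-ext⁺ : ∀ R {t u v} → Steady I R t u v → ext (steadyPart I) R t u v
  steadyPart-ext⁺ (role (name p)) h = h
  steadyPart-ext⁺ (role (inv p))  h = h
  steadyPart-ext⁺ (□F R) (h , _) k t<k =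
    steadyPart-ext⁺ R (h k t<k , inj₂ (inj₁ λ j k≤j → h j (<-≤-trans t<k k≤j)))
  steadyPart-ext⁺ (□P R) (h , _) k k<t =
    steadyPart-ext⁺ R (h k k<t , inj₂ (inj₂ λ j j≤k → h j (≤-<-trans j≤k k<t)))

  steadyPart-satRI : ∀ {ri} → CoreRI ri → SatRI I ri → SatRI (steadyPart I) ri
  steadyPart-satRI {l ⊑r []} _ sat t u v hs with sat t u v (All.map (λ {R} → proj₁ ∘ steadyPart-ext⁻ R) hs)
  ... | ()
  steadyPart-satRI {[] ⊑r (R ∷ [])} _ sat t u v [] =
    here (steadyPart-ext⁺ R (valid t , inj₂ (inj₁ λ k _ → valid k)))
    where
    valid : ∀ k → ext I R k u v
    valid k = singleton⁻ (sat k u v [])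
  steadyPart-satRI {(R₁ ∷ []) ⊑r (R₂ ∷ [])} _ sat t u v (h ∷ []) with steadyPart-ext⁻ R₁ h
  ... | h₁ , anchor = here (steadyPart-ext⁺ R₂ (R₁⊑R₂ t h₁ , map₂ (Ray-map R₁⊑R₂) anchor))
    where
    R₁⊑R₂ : ∀ k → ext I R₁ k u v → ext I R₂ k u v
    R₁⊑R₂ k h₁ = singleton⁻ (sat k u v (h₁ ∷ []))
  steadyPart-satRI {(_ ∷ _ ∷ []) ⊑r (_ ∷ _)} (s≤s (s≤s ()) , _)
  steadyPart-satRI {(_ ∷ _ ∷ _ ∷ _) ⊑r _} (s≤s (s≤s ()) , _)
  steadyPart-satRI {_ ⊑r (_ ∷ _ ∷ _)} (_ , s≤s ())

record Countermodel (ℛ : RBox) (ρ : List Lit) (k : ℤ) (R : TRole) : Set₁ where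
  field
    interp        : Interp
    satisfies     : SatRBox interp ℛ
    source target : Δ interp
    realises      : Realises ρ interp source target
    fails         : ¬ ext interp R k source target

module _ {ℛ : RBox} {ρ : List Lit} {R : TRole} where

  inRod-or-countermodel : Classical → (Q : ℤ → Set) →
    (∀ k → Q k → InRod ℛ ρ k R) ⊎ (∃ λ k → Q k × Countermodel ℛ ρ k R)
  inRod-or-countermodel lem Q with lem {lsuc 0ℓ} {∃ λ k → Q k × Countermodel ℛ ρ k R}
  ... | yes counterexample = inj₂ counterexample
  ... | no  noCounterexample = inj₁ λ k q I sat u v real → holds-or-countermodel k q I sat u v real
    where
    holds-or-countermodel : ∀ k → Q k → ∀ I → SatRBox I ℛ → ∀ u v → Realises ρ I u v → ext I R k u v
    holds-or-countermodel k q I sat u v real with lem {0ℓ} {ext I R k u v}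
    ... | yes holds = holds
    ... | no  fails = ⊥-elim (noCounterexample (k , q , record
      { interp = I ; satisfies = sat ; source = u ; target = v ; realises = real ; fails = fails }))

  core-no-two-sided-countermodels : All CoreRI ℛ → ∀ {n k₁ k₂} → ¬ n ≡ 0ℤ → InRod ℛ ρ n R →
    n ≤ℤ k₁ → Countermodel ℛ ρ k₁ R → k₂ ≤ℤ n → Countermodel ℛ ρ k₂ R → ⊥
  core-no-two-sided-countermodels core {n} {k₁} {k₂} n≢0 rod n≤k₁ c₁ k₂≤n c₂ =
    unanchored (proj₂ (steadyPart-ext⁻ R (rod (steadyPart (I₁ ⊗ I₂)) sat x y real)))
    where
    open Countermodel c₁ renaming
      (interp to I₁; satisfies to sat₁; source to u₁; target to v₁; realises to real₁; fails to fails₁)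
    open Countermodel c₂ renaming
      (interp to I₂; satisfies to sat₂; source to u₂; target to v₂; realises to real₂; fails to fails₂)
    x y : Δ (I₁ ⊗ I₂)
    x = u₁ , u₂
    y = v₁ , v₂
    sat : SatRBox (steadyPart (I₁ ⊗ I₂)) ℛ
    sat = SatRBox-map steadyPart-satRI core (⊗-satRBox (All.map proj₂ core) sat₁ sat₂)
    real : Realises ρ (steadyPart (I₁ ⊗ I₂)) x y
    real R′ R′∈ρ = steadyPart-ext⁺ R′ (⊗-ext⁺ R′ (real₁ R′ R′∈ρ , real₂ R′ R′∈ρ) , inj₁ refl)
    unanchored : n ≡ 0ℤ ⊎ Ray (λ k → ext (I₁ ⊗ I₂) R k x y) n → ⊥
    unanchored (inj₁ n≡0)            = n≢0 n≡0
    unanchored (inj₂ (inj₁ later))   = fails₁ (proj₁ (⊗-ext⁻ R (later k₁ n≤k₁)))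
    unanchored (inj₂ (inj₂ earlier)) = fails₂ (proj₂ (⊗-ext⁻ R (earlier k₂ k₂≤n)))

core-roleMonotone : Classical → ∀ {ℛ} → All CoreRI ℛ → RoleMonotone ℛ
core-roleMonotone lem {ℛ} core ρ _ S n n≢0 rod
  with inRod-or-countermodel {ℛ} {ρ} {role S} lem (n ≤ℤ_) | inRod-or-countermodel {ℛ} {ρ} {role S} lem (_≤ℤ n)
... | inj₁ later | _ = inj₁ later
... | inj₂ _ | inj₁ earlier = inj₂ earlier
... | inj₂ (k₁ , n≤k₁ , c₁) | inj₂ (k₂ , k₂≤n , c₂) =
  ⊥-elim (core-no-two-sided-countermodels core n≢0 rod n≤k₁ c₁ k₂≤n c₂)

theorem29 : Classical →
    ((O : Ontology) → BoolCore O → RoleMonotoneOnt O) ×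
    ((O : Ontology) → BoolHornPlus O → RoleMonotoneOnt O)
theorem29 lem = (λ _ → core-roleMonotone lem) , (λ _ → hornPlus-roleMonotone)
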